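{- Let $M_1,\dots,M_\ell$ be connected graphs and let $\mathcal{F}$ be the class of graphs containing none of $M_1,\dots,M_\ell$ as a minor. For $k\ge1$, let $\mathcal{F}^{(k)}$ be the class of graphs that contain no minor which is a disjoint union of exactly $k$ graphs from $\{M_1,\dots,M_\ell\}$. If $\mathcal{F}$ is closed under weak oddomorphisms, then so is $\mathcal{F}^{(k)}$.
   Context: All graphs are finite, simple, undirected and loopless. Let $\phi\colon F\to G$ be a homomorphism. A vertex $a\in V(F)$ is $\phi$-odd (resp. $\phi$-even) if $|N_F(a)\cap\phi^{ -1}(v)|$ is odd (resp. even) for every $v\in N_G(\phi(a))$. $\phi$ is an oddomorphism if every vertex of $F$ is $\phi$-odd or $\phi$-even and every fibre $\phi^{ -1}(v)$ contains an odd number of $\phi$-odd vertices; $\phi$ is a weak oddomorphism if its restriction to some subgraph $F'$ of $F$ is an oddomorphism $F'\to G$. A class $\mathcal{C}$ is closed under weak oddomorphisms if $F\in\mathcal{C}$ and a weak oddomorphism $F\to G$ imply $G\in\mathcal{C}$. -}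

module Defs where

open import Data.Nat using (ℕ; zero; suc; _+_; _≤_)
open import Data.Bool using (Bool; true; false; not; _∧_; _∨_; if_then_else_)
open import Data.Fin using (Fin; zero; suc; splitAt; _≟_)
open import Data.Sum using (_⊎_; inj₁; inj₂)
open import Data.Product using (Σ; _×_; _,_; ∃; ∃-syntax)
open import Data.Maybe using (Maybe; just; nothing)
open import Data.Unit using (⊤)
open import Relation.Nullary using (¬_)
open import Relation.Nullary.Decidable using (⌊_⌋)
open import Relation.Binary.PropositionalEquality using (_≡_; refl)
open import Function using (_∘_)

record Graph : Set where
  field
    n     : ℕ
    adj   : Fin n → Fin n → Bool
    sym   : ∀ a b → adj a b ≡ adj b a
    irrefl : ∀ a → adj a a ≡ false
open Graph public

count : ∀ {n} → (Fin n → Bool) → ℕ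
count {zero}  p = 0
count {suc n} p = (if p zero then 1 else 0) + count (p ∘ suc)

allFin : ∀ {n} → (Fin n → Bool) → Bool
allFin {zero}  p = true
allFin {suc n} p = p zero ∧ allFin (p ∘ suc)

isOdd : ℕ → Bool
isOdd zero    = false
isOdd (suc m) = not (isOdd m)

Odd Even : ℕ → Set
Odd m  = isOdd m ≡ true
Even m = isOdd m ≡ false

IsHom : (F G : Graph) → (Fin (n F) → Fin (n G)) → Set
IsHom F G φ = ∀ a b → adj F a b ≡ true → adj G (φ a) (φ b) ≡ true

nbrsIn : (F G : Graph) → (Fin (n F) → Fin (n G)) → Fin (n F) → Fin (n G) → ℕ
nbrsIn F G φ a v = count (λ b → adj F a b ∧ ⌊ φ b ≟ v ⌋)

-- a is φ-odd (Boolean version, used for counting; agrees with φOdd below)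
isφOdd : (F G : Graph) → (Fin (n F) → Fin (n G)) → Fin (n F) → Bool
isφOdd  F G φ a = allFin (λ v → not (adj G (φ a) v) ∨ isOdd (nbrsIn F G φ a v))

φOdd φEven : (F G : Graph) → (Fin (n F) → Fin (n G)) → Fin (n F) → Set
φOdd  F G φ a = ∀ v → adj G (φ a) v ≡ true → Odd  (nbrsIn F G φ a v)
φEven F G φ a = ∀ v → adj G (φ a) v ≡ true → Even (nbrsIn F G φ a v)

oddInFibre : (F G : Graph) → (Fin (n F) → Fin (n G)) → Fin (n G) → ℕ
oddInFibre F G φ v = count (λ a → ⌊ φ a ≟ v ⌋ ∧ isφOdd F G φ a)

IsOddomorphism : (F G : Graph) → (Fin (n F) → Fin (n G)) → Set
IsOddomorphism F G φ =
  IsHom F G φ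
  × (∀ a → φOdd F G φ a ⊎ φEven F G φ a)
  × (∀ v → Odd (oddInFibre F G φ v))

-- Subgraphs of F are represented (up to isomorphism) by a graph F'
-- together with an injective homomorphism ι : F' → F (vertex and edge
-- inclusion); the restriction of φ to F' is then φ ∘ ι.
IsSubgraphEmb : (F' F : Graph) → (Fin (n F') → Fin (n F)) → Set
IsSubgraphEmb F' F ι = (∀ a b → ι a ≡ ι b → a ≡ b) × IsHom F' F ι

IsWeakOddomorphism : (F G : Graph) → (Fin (n F) → Fin (n G)) → Set
IsWeakOddomorphism F G φ =
  IsHom F G φ ×
  Σ Graph (λ F' → Σ (Fin (n F') → Fin (n F)) (λ ι →
    IsSubgraphEmb F' F ι × IsOddomorphism F' G (φ ∘ ι)))

ClosedUnderWeakOddo : (Graph → Set) → Set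
ClosedUnderWeakOddo C =
  ∀ (F G : Graph) (φ : Fin (n F) → Fin (n G)) →
    C F → IsWeakOddomorphism F G φ → C G

data Walk (G : Graph) (P : Fin (n G) → Set) : Fin (n G) → Fin (n G) → Set where
  here : ∀ {x} → Walk G P x x
  step : ∀ {x z y} → adj G x z ≡ true → P z → Walk G P z y → Walk G P x y

Connected : Graph → Set
Connected G = (1 ≤ n G) × (∀ x y → Walk G (λ _ → ⊤) x y)

-- β x = just h : vertex x of G lies in the branch set of h ∈ V(H);
-- β x = nothing : x is deleted.
IsMinorModel : (H G : Graph) → (Fin (n G) → Maybe (Fin (n H))) → Set
IsMinorModel H G β =
  (∀ h → ∃[ x ] β x ≡ just h)
  × (∀ h x y → β x ≡ just h → β y ≡ just h →
       Walk G (λ z → β z ≡ just h) x y)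
  × (∀ h h' → adj H h h' ≡ true →
       ∃[ x ] ∃[ y ] (β x ≡ just h × β y ≡ just h' × adj G x y ≡ true))

_≼_ : Graph → Graph → Set
H ≼ G = Σ (Fin (n G) → Maybe (Fin (n H))) (IsMinorModel H G)

emptyGraph : Graph
emptyGraph = record { n = 0 ; adj = λ () ; sym = λ () ; irrefl = λ () }

module _ (G H : Graph) where
  adj⊕ : Fin (n G) ⊎ Fin (n H) → Fin (n G) ⊎ Fin (n H) → Bool
  adj⊕ (inj₁ x) (inj₁ y) = adj G x y
  adj⊕ (inj₂ x) (inj₂ y) = adj H x y
  adj⊕ (inj₁ _) (inj₂ _) = false
  adj⊕ (inj₂ _) (inj₁ _) = false

  adj⊕-sym : ∀ u w → adj⊕ u w ≡ adj⊕ w u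
  adj⊕-sym (inj₁ x) (inj₁ y) = sym G x y
  adj⊕-sym (inj₂ x) (inj₂ y) = sym H x y
  adj⊕-sym (inj₁ _) (inj₂ _) = refl
  adj⊕-sym (inj₂ _) (inj₁ _) = refl

  adj⊕-irr : ∀ u → adj⊕ u u ≡ false
  adj⊕-irr (inj₁ x) = irrefl G x
  adj⊕-irr (inj₂ x) = irrefl H x

_⊕_ : Graph → Graph → Graph
G ⊕ H = record
  { n = n G + n H
  ; adj = λ a b → adj⊕ G H (splitAt (n G) a) (splitAt (n G) b)
  ; sym = λ a b → adj⊕-sym G H (splitAt (n G) a) (splitAt (n G) b)
  ; irrefl = λ a → adj⊕-irr G H (splitAt (n G) a)
  }

⨄ : ∀ {k} → (Fin k → Graph) → Graph
⨄ {zero}  M = emptyGraph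
⨄ {suc k} M = M zero ⊕ ⨄ (M ∘ suc)

Excl : ∀ {ℓ} → (Fin ℓ → Graph) → Graph → Set
Excl M G = ∀ i → ¬ (M i ≼ G)

-- 𝓕^(k) : graphs containing no minor that is a disjoint union of exactly
-- k graphs from {M 1, …, M ℓ} (repetitions allowed)
Excl^ : ∀ {ℓ} → (Fin ℓ → Graph) → ℕ → Graph → Set
Excl^ {ℓ} M k G = ∀ (c : Fin k → Fin ℓ) → ¬ (⨄ (M ∘ c) ≼ G)

-- The minor models of the k excluded components in G have pairwise disjoint vertex sets, so it
-- suffices to pull each component back into F inside the preimage of its branch sets V. A
-- one-vertex component pulls back through any vertex of its fibre, which is nonempty as it
-- contains an odd number of φ-odd vertices. Otherwise the component is connected with at least
-- two vertices, so G[V] has no isolated vertex; then every vertex of V sees a neighbouring fibre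
-- inside V, φ-parities survive the restriction, and φ restricts to a weak oddomorphism
-- F[φ⁻¹V] → G[V]. As G[V] contains M i, closure of 𝓕 forbids F[φ⁻¹V] ∈ 𝓕, so some M j is a minor
-- inside φ⁻¹V. The pulled-back models are again disjoint and combine to a minor of F of the
-- excluded shape. Since 𝓕 only forbids minors, each pull-back is obtained double-negated.

module Submission where

open import Defs
open import Data.Nat using (ℕ; zero; suc; _+_; _≤_)
open import Data.Bool using (Bool; true; false; not; _∧_; _∨_; if_then_else_)
open import Data.Bool.Properties using (∧-conicalˡ; ∧-conicalʳ)
open import Data.Fin using (Fin; zero; suc; fromℕ<; _≟_; splitAt; _↑ˡ_; _↑ʳ_)
open import Data.Fin.Properties
  using (suc-injective; splitAt-↑ˡ; splitAt-↑ʳ; splitAt⁻¹-↑ˡ; splitAt⁻¹-↑ʳ; ↑ˡ-injective; ↑ʳ-injective)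
open import Data.Maybe using (Maybe; just; nothing; is-just)
import Data.Maybe as Maybe
open import Data.Maybe.Properties using (just-injective)
open import Data.Sum using (_⊎_; inj₁; inj₂; [_,_]′)
import Data.Sum
open import Data.Product using (Σ; Σ-syntax; _×_; _,_; ∃-syntax; proj₁; proj₂)
open import Data.Empty using (⊥; ⊥-elim)
open import Relation.Nullary using (¬_; yes; no)
open import Relation.Nullary.Negation using (¬¬-Monad)
open import Effect.Monad using (RawMonad)
open import Level using (0ℓ)
open import Data.Vec.Functional using (_∷_)
open import Relation.Nullary.Decidable using (⌊_⌋)
import Relation.Binary.PropositionalEquality as ≡
open ≡ using (_≡_; _≢_; refl; trans; cong; cong₂; subst; subst₂)
open import Function using (_∘_; const)

false≢true : false ≢ true
false≢true ()

≟⇒≡ : ∀ {m} (x y : Fin m) → ⌊ x ≟ y ⌋ ≡ true → x ≡ y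
≟⇒≡ x y e with x ≟ y
... | yes x≡y = x≡y
≟⇒≡ x y () | no _

≟-refl : ∀ {m} (x : Fin m) → ⌊ x ≟ x ⌋ ≡ true
≟-refl x with x ≟ x
... | yes _ = refl
... | no x≢x = ⊥-elim (x≢x refl)

≟-cong : ∀ {m m'} {x y : Fin m} {x' y' : Fin m'} →
         (x ≡ y → x' ≡ y') → (x' ≡ y' → x ≡ y) → ⌊ x ≟ y ⌋ ≡ ⌊ x' ≟ y' ⌋
≟-cong {x = x} {y} {x'} {y'} to from with x ≟ y | x' ≟ y'
... | yes _   | yes _    = refl
... | no _    | no _     = refl
... | yes x≡y | no x'≢y' = ⊥-elim (x'≢y' (to x≡y))
... | no x≢y  | yes x'≡y' = ⊥-elim (x≢y (from x'≡y'))

≡true-ext : ∀ {b c : Bool} → (b ≡ true → c ≡ true) → (c ≡ true → b ≡ true) → b ≡ c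
≡true-ext {true}  {true}  _ _ = refl
≡true-ext {true}  {false} f _ = ≡.sym (f refl)
≡true-ext {false} {true}  _ g = g refl
≡true-ext {false} {false} _ _ = refl

count-cong : ∀ {n} {p q : Fin n → Bool} → (∀ x → p x ≡ q x) → count p ≡ count q
count-cong {zero}  p≗q = refl
count-cong {suc n} p≗q rewrite p≗q zero = cong (_ +_) (count-cong (p≗q ∘ suc))

count≢0⇒∃ : ∀ {n} (p : Fin n → Bool) → count p ≢ 0 → ∃[ x ] p x ≡ true
count≢0⇒∃ {zero}  p c≢0 = ⊥-elim (c≢0 refl)
count≢0⇒∃ {suc n} p c≢0 with p zero in p0
... | true  = zero , p0
... | false with count≢0⇒∃ (p ∘ suc) c≢0
...   | x , px = suc x , px

Odd⇒≢0 : ∀ {m} → Odd m → m ≢ 0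
Odd⇒≢0 {zero} ()
Odd⇒≢0 {suc m} _ ()

allFin⇒∀ : ∀ {n} (p : Fin n → Bool) → allFin p ≡ true → ∀ x → p x ≡ true
allFin⇒∀ p all zero    = ∧-conicalˡ (p zero) _ all
allFin⇒∀ p all (suc x) = allFin⇒∀ (p ∘ suc) (∧-conicalʳ (p zero) _ all) x

∀⇒allFin : ∀ {n} (p : Fin n → Bool) → (∀ x → p x ≡ true) → allFin p ≡ true
∀⇒allFin {zero}  p all = refl
∀⇒allFin {suc n} p all rewrite all zero = ∀⇒allFin (p ∘ suc) (all ∘ suc)

private
  selectStep : ∀ {n m} (b : Bool) → (Fin m → Fin n) → Fin ((if b then 1 else 0) + m) → Fin (suc n)
  selectStep true  s zero    = zero
  selectStep true  s (suc j) = suc (s j)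
  selectStep false s j       = suc (s j)

  indexHere : ∀ {m} (b : Bool) → b ≡ true → Fin ((if b then 1 else 0) + m)
  indexHere true refl = zero

  indexThere : ∀ {m} (b : Bool) → Fin m → Fin ((if b then 1 else 0) + m)
  indexThere true  j = suc j
  indexThere false j = j

select : ∀ {n} (P : Fin n → Bool) → Fin (count P) → Fin n
select {suc n} P = selectStep (P zero) (select (P ∘ suc))

index : ∀ {n} (P : Fin n → Bool) (x : Fin n) → P x ≡ true → Fin (count P)
index P zero    px = indexHere (P zero) px
index P (suc x) px = indexThere (P zero) (index (P ∘ suc) x px)

select-index : ∀ {n} (P : Fin n → Bool) x (px : P x ≡ true) → select P (index P x px) ≡ x
select-index P zero px = atHere (P zero) px
  where
  atHere : ∀ {m n} b {s : Fin m → Fin n} (b≡true : b ≡ true) → selectStep b s (indexHere b b≡true) ≡ zero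
  atHere true refl = refl
select-index P (suc x) px = trans (atThere (P zero)) (cong suc (select-index (P ∘ suc) x px))
  where
  atThere : ∀ {m n} b {s : Fin m → Fin n} {j} → selectStep b s (indexThere b j) ≡ suc (s j)
  atThere true  = refl
  atThere false = refl

select-sat : ∀ {n} (P : Fin n → Bool) j → P (select P j) ≡ true
select-sat {suc n} P = go (P zero) refl
  where
  go : ∀ b → P zero ≡ b → ∀ j → P (selectStep b (select (P ∘ suc)) j) ≡ true
  go true  P0 zero    = P0
  go true  P0 (suc j) = select-sat (P ∘ suc) j
  go false P0 j       = select-sat (P ∘ suc) j

select-injective : ∀ {n} (P : Fin n → Bool) {i j} → select P i ≡ select P j → i ≡ j
select-injective {suc n} P = go (P zero)
  where
  go : ∀ b {i j} → selectStep b (select (P ∘ suc)) i ≡ selectStep b (select (P ∘ suc)) j → i ≡ j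
  go true  {zero}  {zero}  e = refl
  go true  {suc i} {suc j} e = cong suc (select-injective (P ∘ suc) (suc-injective e))
  go false         e         = select-injective (P ∘ suc) (suc-injective e)

index-select : ∀ {n} (P : Fin n → Bool) j (p : P (select P j) ≡ true) → index P (select P j) p ≡ j
index-select P j p = select-injective P (select-index P (select P j) p)

select-≟ : ∀ {n} (P : Fin n → Bool) (i j : Fin (count P)) → ⌊ select P i ≟ select P j ⌋ ≡ ⌊ i ≟ j ⌋
select-≟ P i j = ≟-cong (select-injective P) (cong (select P))

count-select : ∀ {n} (P q : Fin n → Bool) → count (q ∘ select P) ≡ count (λ x → P x ∧ q x)
count-select {zero}  P q = refl
count-select {suc n} P q = go (P zero) refl
  where
  go : ∀ b → P zero ≡ b → count (q ∘ selectStep b (select (P ∘ suc))) ≡ count (λ x → P x ∧ q x)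
  go true  P0 rewrite P0 = cong (_ +_) (count-select (P ∘ suc) (q ∘ suc))
  go false P0 rewrite P0 = count-select (P ∘ suc) (q ∘ suc)

count-∘select : ∀ {n} (P q : Fin n → Bool) → (∀ x → q x ≡ true → P x ≡ true) →
                count (q ∘ select P) ≡ count q
count-∘select P q q⊆P = trans (count-select P q) (count-cong (λ x → absorb (P x) (q⊆P x)))
  where
  absorb : ∀ p {r} → (r ≡ true → p ≡ true) → p ∧ r ≡ r
  absorb true  _ = refl
  absorb false {true} r⇒p = r⇒p refl
  absorb false {false} _ = refl

index-irrelevant : ∀ {n} (P : Fin n → Bool) x (p q : P x ≡ true) → index P x p ≡ index P x q
index-irrelevant P x p q = select-injective P (trans (select-index P x p) (≡.sym (select-index P x q)))

private
  extendAt : ∀ {n} {A : Set} (P : Fin n → Bool) → (Fin (count P) → Maybe A) → ∀ x b → P x ≡ b → Maybe A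
  extendAt P γ x true  px = γ (index P x px)
  extendAt P γ x false _  = nothing

extend : ∀ {n} {A : Set} (P : Fin n → Bool) → (Fin (count P) → Maybe A) → Fin n → Maybe A
extend P γ x = extendAt P γ x (P x) refl

extend-sat : ∀ {n} {A : Set} (P : Fin n → Bool) (γ : Fin (count P) → Maybe A) x (px : P x ≡ true) →
             extend P γ x ≡ γ (index P x px)
extend-sat P γ x px = at (P x) refl
  where
  at : ∀ b (e : P x ≡ b) → extendAt P γ x b e ≡ γ (index P x px)
  at true  e = cong γ (index-irrelevant P x e px)
  at false e = ⊥-elim (false≢true (trans (≡.sym e) px))

extend-select : ∀ {n} {A : Set} (P : Fin n → Bool) (γ : Fin (count P) → Maybe A) j →
                extend P γ (select P j) ≡ γ j
extend-select P γ j =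
  trans (extend-sat P γ (select P j) (select-sat P j)) (cong γ (index-select P j (select-sat P j)))

extend≡just : ∀ {n} {A : Set} (P : Fin n → Bool) (γ : Fin (count P) → Maybe A) x {a} →
              extend P γ x ≡ just a → ∃[ j ] select P j ≡ x × γ j ≡ just a
extend≡just P γ x = at (P x) refl
  where
  at : ∀ {a} b (e : P x ≡ b) → extendAt P γ x b e ≡ just a → ∃[ j ] select P j ≡ x × γ j ≡ just a
  at true e γ≡ = index P x e , select-index P x e , γ≡

induced : (G : Graph) → (Fin (n G) → Bool) → Graph
induced G P = record
  { n      = count P
  ; adj    = λ a b → adj G (select P a) (select P b)
  ; sym    = λ a b → Graph.sym G (select P a) (select P b)
  ; irrefl = λ a → irrefl G (select P a)
  }

Walk-map : ∀ {G₁ G₂ : Graph} {Q₁ : Fin (n G₁) → Set} {Q₂ : Fin (n G₂) → Set}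
           (f : Fin (n G₁) → Fin (n G₂)) → IsHom G₁ G₂ f → (∀ z → Q₁ z → Q₂ (f z)) →
           ∀ {x y} → Walk G₁ Q₁ x y → Walk G₂ Q₂ (f x) (f y)
Walk-map f hom Q₁⇒Q₂ here         = here
Walk-map f hom Q₁⇒Q₂ (step e q w) = step (hom _ _ e) (Q₁⇒Q₂ _ q) (Walk-map f hom Q₁⇒Q₂ w)

Walk-weaken : ∀ {G : Graph} {Q₁ Q₂ : Fin (n G) → Set} → (∀ z → Q₁ z → Q₂ z) →
              ∀ {x y} → Walk G Q₁ x y → Walk G Q₂ x y
Walk-weaken = Walk-map (λ z → z) (λ _ _ e → e)

Walk-head : ∀ {G : Graph} {Q : Fin (n G) → Set} {x y} → Walk G Q x y →
            x ≡ y ⊎ ∃[ z ] adj G x z ≡ true × Q z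
Walk-head here         = inj₁ refl
Walk-head (step e q _) = inj₂ (_ , e , q)

Walk-induced : ∀ {G : Graph} {P : Fin (n G) → Bool} {Q : Fin (n G) → Set} →
               (∀ z → Q z → P z ≡ true) → ∀ {x y} → Walk G Q x y →
               ∀ {i j} → select P i ≡ x → select P j ≡ y → Walk (induced G P) (Q ∘ select P) i j
Walk-induced {P = P} Q⊆P here i≡x j≡y = subst (Walk _ _ _) (select-injective P (trans i≡x (≡.sym j≡y))) here
Walk-induced {G = G} {P} {Q} Q⊆P (step {z = z} e q w) refl j≡y =
  step (subst (λ t → adj G _ t ≡ true) (≡.sym sel) e) (subst Q (≡.sym sel) q) (Walk-induced Q⊆P w sel j≡y)
  where
  sel : select P (index P z (Q⊆P z q)) ≡ z
  sel = select-index P z (Q⊆P z q)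

Within : ∀ {m} {A : Set} → (Fin m → Maybe A) → (Fin m → Bool) → Set
Within β R = ∀ x {h} → β x ≡ just h → R x ≡ true

record MinorWithin (H G : Graph) (R : Fin (n G) → Bool) : Set where
  constructor minorWithin
  field
    branch   : Fin (n G) → Maybe (Fin (n H))
    isModel  : IsMinorModel H G branch
    branch⊆R : Within branch R
open MinorWithin

support : ∀ {m} {A : Set} → (Fin m → Maybe A) → Fin m → Bool
support β = is-just ∘ β

Within-support : ∀ {m} {A : Set} (β : Fin m → Maybe A) → Within β (support β)
Within-support β x β≡just = cong is-just β≡just

support⊆ : ∀ {m} {A : Set} {β : Fin m → Maybe A} {R} → Within β R → ∀ x → support β x ≡ true → R x ≡ true
support⊆ {β = β} β⊆R x with β x in βx
... | just _ = λ _ → β⊆R x βx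

MinorWithin-weaken : ∀ {H G : Graph} {R R' : Fin (n G) → Bool} →
                     (∀ x → R x ≡ true → R' x ≡ true) → MinorWithin H G R → MinorWithin H G R'
MinorWithin-weaken R⊆R' (minorWithin β model β⊆R) = minorWithin β model λ x βx → R⊆R' x (β⊆R x βx)

MinorWithin⇒≼induced : ∀ {H G : Graph} {P : Fin (n G) → Bool} → MinorWithin H G P → H ≼ induced G P
MinorWithin⇒≼induced {H} {G} {P} (minorWithin β (onto , connected , edges) β⊆P) =
  β ∘ select P , onto′ , connected′ , edges′
  where
  index′ : ∀ {x h} → β x ≡ just h → Fin (count P)
  index′ βx = index P _ (β⊆P _ βx)

  sel : ∀ {x h} (βx : β x ≡ just h) → select P (index′ βx) ≡ x
  sel βx = select-index P _ (β⊆P _ βx)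

  at-index : ∀ {x h} (βx : β x ≡ just h) → β (select P (index′ βx)) ≡ just h
  at-index βx = trans (cong β (sel βx)) βx

  onto′ : ∀ h → ∃[ i ] β (select P i) ≡ just h
  onto′ h with onto h
  ... | x , βx = index′ βx , at-index βx

  connected′ : ∀ h i j → β (select P i) ≡ just h → β (select P j) ≡ just h →
               Walk (induced G P) (λ z → β (select P z) ≡ just h) i j
  connected′ h i j βi βj = Walk-induced (λ z → β⊆P z) (connected h _ _ βi βj) refl refl

  edges′ : ∀ h h' → adj H h h' ≡ true →
           ∃[ i ] ∃[ j ] (β (select P i) ≡ just h × β (select P j) ≡ just h' × adj (induced G P) i j ≡ true)
  edges′ h h' hh' with edges h h' hh'
  ... | x , y , βx , βy , xy =
    index′ βx , index′ βy , at-index βx , at-index βy ,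
    subst₂ (λ s t → adj G s t ≡ true) (≡.sym (sel βx)) (≡.sym (sel βy)) xy

≼induced⇒MinorWithin : ∀ {H G : Graph} {P : Fin (n G) → Bool} → H ≼ induced G P → MinorWithin H G P
≼induced⇒MinorWithin {H} {G} {P} (γ , onto , connected , edges) =
  minorWithin β (onto′ , connected′ , edges′) β⊆P
  where
  β : Fin (n G) → Maybe (Fin (n H))
  β = extend P γ

  β⊆P : Within β P
  β⊆P x βx with extend≡just P γ x βx
  ... | j , refl , _ = select-sat P j

  onto′ : ∀ h → ∃[ x ] β x ≡ just h
  onto′ h with onto h
  ... | j , γj = select P j , trans (extend-select P γ j) γj

  connected′ : ∀ h x y → β x ≡ just h → β y ≡ just h → Walk G (λ z → β z ≡ just h) x y
  connected′ h x y βx βy with extend≡just P γ x βx | extend≡just P γ y βy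
  ... | i , refl , γi | j , refl , γj =
    Walk-map (select P) (λ _ _ e → e) (λ z γz → trans (extend-select P γ z) γz) (connected h i j γi γj)

  edges′ : ∀ h h' → adj H h h' ≡ true → ∃[ x ] ∃[ y ] (β x ≡ just h × β y ≡ just h' × adj G x y ≡ true)
  edges′ h h' hh' with edges h h' hh'
  ... | i , j , γi , γj , ij =
    select P i , select P j , trans (extend-select P γ i) γi , trans (extend-select P γ j) γj , ij

record InducedEmbedding (H₁ H : Graph) : Set where
  field
    embed         : Fin (n H₁) → Fin (n H)
    retract       : Fin (n H) → Maybe (Fin (n H₁))
    retract-embed : ∀ h → retract (embed h) ≡ just h
    retract≡just  : ∀ u {h} → retract u ≡ just h → embed h ≡ u
    adj-embed     : ∀ h h' → adj H (embed h) (embed h') ≡ adj H₁ h h'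

module _ {H₁ H : Graph} (ε : InducedEmbedding H₁ H) where
  open InducedEmbedding ε

  retractModel : ∀ {m} → (Fin m → Maybe (Fin (n H))) → Fin m → Maybe (Fin (n H₁))
  retractModel β x = β x Maybe.>>= retract

  retractModel≡just : ∀ {m} (β : Fin m → Maybe (Fin (n H))) x {h} →
                      retractModel β x ≡ just h → β x ≡ just (embed h)
  retractModel≡just β x e with β x
  ... | just u = cong just (≡.sym (retract≡just u e))

  just-embed : ∀ {m} (β : Fin m → Maybe (Fin (n H))) x {h} →
               β x ≡ just (embed h) → retractModel β x ≡ just h
  just-embed β x βx rewrite βx = retract-embed _

  MinorWithin-retract : ∀ {G : Graph} {R} → MinorWithin H G R → MinorWithin H₁ G R
  MinorWithin-retract {G} (minorWithin β (onto , connected , edges) β⊆R) =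
    minorWithin (retractModel β) (onto′ , connected′ , edges′) λ x e → β⊆R x (retractModel≡just β x e)
    where
    onto′ : ∀ h → ∃[ x ] retractModel β x ≡ just h
    onto′ h with onto (embed h)
    ... | x , βx = x , just-embed β x βx

    connected′ : ∀ h x y → retractModel β x ≡ just h → retractModel β y ≡ just h →
                 Walk G (λ z → retractModel β z ≡ just h) x y
    connected′ h x y βx βy =
      Walk-weaken (λ z → just-embed β z)
        (connected (embed h) x y (retractModel≡just β x βx) (retractModel≡just β y βy))

    edges′ : ∀ h h' → adj H₁ h h' ≡ true →
             ∃[ x ] ∃[ y ] (retractModel β x ≡ just h × retractModel β y ≡ just h' × adj G x y ≡ true)
    edges′ h h' hh' with edges (embed h) (embed h') (trans (adj-embed h h') hh')
    ... | x , y , βx , βy , xy = x , y , just-embed β x βx , just-embed β y βy , xy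

module _ (H₁ H₂ : Graph) where
  private
    a = n H₁
    b = n H₂

  ⊕-adj-↑ˡ : ∀ h h' → adj (H₁ ⊕ H₂) (h ↑ˡ b) (h' ↑ˡ b) ≡ adj H₁ h h'
  ⊕-adj-↑ˡ h h' rewrite splitAt-↑ˡ a h b | splitAt-↑ˡ a h' b = refl

  ⊕-adj-↑ʳ : ∀ h h' → adj (H₁ ⊕ H₂) (a ↑ʳ h) (a ↑ʳ h') ≡ adj H₂ h h'
  ⊕-adj-↑ʳ h h' rewrite splitAt-↑ʳ a b h | splitAt-↑ʳ a b h' = refl

  ⊕-adj-↑ˡ-↑ʳ : ∀ h h' → adj (H₁ ⊕ H₂) (h ↑ˡ b) (a ↑ʳ h') ≡ false
  ⊕-adj-↑ˡ-↑ʳ h h' rewrite splitAt-↑ˡ a h b | splitAt-↑ʳ a b h' = refl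

  retractˡ : Fin (a + b) → Maybe (Fin a)
  retractˡ u = [ just , const nothing ]′ (splitAt a u)

  retractʳ : Fin (a + b) → Maybe (Fin b)
  retractʳ u = [ const nothing , just ]′ (splitAt a u)

  ⊕-embedˡ : InducedEmbedding H₁ (H₁ ⊕ H₂)
  ⊕-embedˡ = record
    { embed         = _↑ˡ b
    ; retract       = retractˡ
    ; retract-embed = λ h → cong [ just , const nothing ]′ (splitAt-↑ˡ a h b)
    ; retract≡just  = retract≡just
    ; adj-embed     = ⊕-adj-↑ˡ
    }
    where
    retract≡just : ∀ u {h} → retractˡ u ≡ just h → h ↑ˡ b ≡ u
    retract≡just u e with splitAt a u in eq
    retract≡just u refl | inj₁ _ = splitAt⁻¹-↑ˡ eq

  ⊕-embedʳ : InducedEmbedding H₂ (H₁ ⊕ H₂)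
  ⊕-embedʳ = record
    { embed         = a ↑ʳ_
    ; retract       = retractʳ
    ; retract-embed = λ h → cong [ const nothing , just ]′ (splitAt-↑ʳ a b h)
    ; retract≡just  = retract≡just
    ; adj-embed     = ⊕-adj-↑ʳ
    }
    where
    retract≡just : ∀ u {h} → retractʳ u ≡ just h → a ↑ʳ h ≡ u
    retract≡just u e with splitAt a u in eq
    retract≡just u refl | inj₂ _ = splitAt⁻¹-↑ʳ eq

  retractˡ-retractʳ-disjoint : ∀ m → is-just (m Maybe.>>= retractˡ) ≡ true →
                                is-just (m Maybe.>>= retractʳ) ≡ true → ⊥
  retractˡ-retractʳ-disjoint (just u) l r with splitAt a u
  retractˡ-retractʳ-disjoint (just u) l () | inj₁ _
  retractˡ-retractʳ-disjoint (just u) () r | inj₂ _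

data SumView (a b : ℕ) : Fin (a + b) → Set where
  left  : ∀ h → SumView a b (h ↑ˡ b)
  right : ∀ h → SumView a b (a ↑ʳ h)

sumView : ∀ a b u → SumView a b u
sumView a b u with splitAt a u in eq
... | inj₁ h = subst (SumView a b) (splitAt⁻¹-↑ˡ eq) (left h)
... | inj₂ h = subst (SumView a b) (splitAt⁻¹-↑ʳ eq) (right h)

↑ˡ≢↑ʳ : ∀ {a b} (h : Fin a) (h' : Fin b) → h ↑ˡ b ≢ a ↑ʳ h'
↑ˡ≢↑ʳ {a} {b} h h' e with trans (≡.sym (splitAt-↑ˡ a h b)) (trans (cong (splitAt a) e) (splitAt-↑ʳ a b h'))
... | ()

record DisjointParts {m} (R : Fin m → Bool) : Set where
  field
    part₁ part₂ : Fin m → Bool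
    disjoint    : ∀ x → part₁ x ≡ true → part₂ x ≡ true → ⊥
    part₁⊆      : ∀ x → part₁ x ≡ true → R x ≡ true
    part₂⊆      : ∀ x → part₂ x ≡ true → R x ≡ true
open DisjointParts

DisjointParts-∘ : ∀ {m k} {R : Fin m → Bool} → DisjointParts R → (f : Fin k → Fin m) → DisjointParts (R ∘ f)
DisjointParts-∘ D f = record
  { part₁ = part₁ D ∘ f ; part₂ = part₂ D ∘ f
  ; disjoint = disjoint D ∘ f ; part₁⊆ = part₁⊆ D ∘ f ; part₂⊆ = part₂⊆ D ∘ f }

MinorWithin-support : ∀ {H G : Graph} {R} (m : MinorWithin H G R) → MinorWithin H G (support (branch m))
MinorWithin-support (minorWithin β model _) = minorWithin β model (Within-support β)

MinorWithin-⊕-split : ∀ {H₁ H₂ G : Graph} {R} → MinorWithin (H₁ ⊕ H₂) G R →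
                      Σ (DisjointParts R) λ D → MinorWithin H₁ G (part₁ D) × MinorWithin H₂ G (part₂ D)
MinorWithin-⊕-split {H₁} {H₂} {G} {R} m = D , MinorWithin-support m₁ , MinorWithin-support m₂
  where
  m₁ = MinorWithin-retract (⊕-embedˡ H₁ H₂) m
  m₂ = MinorWithin-retract (⊕-embedʳ H₁ H₂) m

  D : DisjointParts R
  D = record
    { part₁ = support (branch m₁) ; part₂ = support (branch m₂)
    ; disjoint = λ x → retractˡ-retractʳ-disjoint H₁ H₂ (branch m x)
    ; part₁⊆ = support⊆ (branch⊆R m₁) ; part₂⊆ = support⊆ (branch⊆R m₂) }

MinorWithin-⊕-combine : ∀ {H₁ H₂ G : Graph} {R} (D : DisjointParts R) →
                        MinorWithin H₁ G (part₁ D) → MinorWithin H₂ G (part₂ D) → MinorWithin (H₁ ⊕ H₂) G R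
MinorWithin-⊕-combine {H₁} {H₂} {G} D (minorWithin β₁ (onto₁ , connected₁ , edges₁) β₁⊆)
                                       (minorWithin β₂ (onto₂ , connected₂ , edges₂) β₂⊆) =
  minorWithin β (onto , connected , edges) β⊆R
  where
  a = n H₁
  b = n H₂

  β : Fin (n G) → Maybe (Fin (a + b))
  β x = Maybe.map (_↑ˡ b) (β₁ x) Maybe.<∣> Maybe.map (a ↑ʳ_) (β₂ x)

  inˡ : ∀ {x h} → β₁ x ≡ just h → β x ≡ just (h ↑ˡ b)
  inˡ β₁x rewrite β₁x = refl

  inʳ : ∀ {x h} → β₂ x ≡ just h → β x ≡ just (a ↑ʳ h)
  inʳ {x} β₂x with β₁ x in β₁x
  ... | just _  = ⊥-elim (disjoint D x (β₁⊆ x β₁x) (β₂⊆ x β₂x))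
  ... | nothing rewrite β₂x = refl

  outˡ : ∀ x {h} → β x ≡ just (h ↑ˡ b) → β₁ x ≡ just h
  outˡ x e with β₁ x | β₂ x
  ... | just h' | _       = cong just (↑ˡ-injective b h' _ (just-injective e))
  ... | nothing | just h' = ⊥-elim (↑ˡ≢↑ʳ _ h' (≡.sym (just-injective e)))

  outʳ : ∀ x {h} → β x ≡ just (a ↑ʳ h) → β₂ x ≡ just h
  outʳ x e with β₁ x | β₂ x
  ... | just h' | _       = ⊥-elim (↑ˡ≢↑ʳ h' _ (just-injective e))
  ... | nothing | just h' = cong just (↑ʳ-injective a h' _ (just-injective e))

  β⊆R : Within β _
  β⊆R x e with β₁ x in β₁x | β₂ x in β₂x
  ... | just _  | _      = part₁⊆ D x (β₁⊆ x β₁x)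
  ... | nothing | just _ = part₂⊆ D x (β₂⊆ x β₂x)

  onto : ∀ u → ∃[ x ] β x ≡ just u
  onto u with sumView a b u
  ... | left h  = proj₁ (onto₁ h) , inˡ (proj₂ (onto₁ h))
  ... | right h = proj₁ (onto₂ h) , inʳ (proj₂ (onto₂ h))

  connected : ∀ u x y → β x ≡ just u → β y ≡ just u → Walk G (λ z → β z ≡ just u) x y
  connected u x y βx βy with sumView a b u
  ... | left h  = Walk-weaken (λ _ → inˡ) (connected₁ h x y (outˡ x βx) (outˡ y βy))
  ... | right h = Walk-weaken (λ _ → inʳ) (connected₂ h x y (outʳ x βx) (outʳ y βy))

  edges : ∀ u u' → adj (H₁ ⊕ H₂) u u' ≡ true →
          ∃[ x ] ∃[ y ] (β x ≡ just u × β y ≡ just u' × adj G x y ≡ true)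
  edges u u' uu' with sumView a b u | sumView a b u'
  ... | left h | left h' with edges₁ h h' (trans (≡.sym (⊕-adj-↑ˡ H₁ H₂ h h')) uu')
  ...   | x , y , βx , βy , xy = x , y , inˡ βx , inˡ βy , xy
  edges u u' uu' | right h | right h' with edges₂ h h' (trans (≡.sym (⊕-adj-↑ʳ H₁ H₂ h h')) uu')
  ...   | x , y , βx , βy , xy = x , y , inʳ βx , inʳ βy , xy
  edges u u' uu' | left h | right h' = ⊥-elim (false≢true (trans (≡.sym (⊕-adj-↑ˡ-↑ʳ H₁ H₂ h h')) uu'))
  edges u u' uu' | right h | left h' =
    ⊥-elim (false≢true (trans (≡.sym (⊕-adj-↑ˡ-↑ʳ H₁ H₂ h' h)) (trans (Graph.sym (H₁ ⊕ H₂) _ _) uu')))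

emptyMinor : ∀ {G : Graph} {R} → MinorWithin emptyGraph G R
emptyMinor = minorWithin (λ _ → nothing) ((λ ()) , (λ ()) , (λ ())) λ _ ()

isφOdd⇒φOdd : ∀ F G φ a → isφOdd F G φ a ≡ true → φOdd F G φ a
isφOdd⇒φOdd F G φ a odd v av = implies (allFin⇒∀ _ odd v) av
  where
  implies : ∀ {b c} → not b ∨ c ≡ true → b ≡ true → c ≡ true
  implies {true} c refl = c

φOdd⇒isφOdd : ∀ F G φ a → φOdd F G φ a → isφOdd F G φ a ≡ true
φOdd⇒isφOdd F G φ a odd = ∀⇒allFin _ (λ v → implied (odd v))
  where
  implied : ∀ {b c} → (b ≡ true → c ≡ true) → not b ∨ c ≡ true
  implied {true}  b⇒c = b⇒c refl
  implied {false} _   = refl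

record Restricts {n m} (P : Fin n → Bool) (Q : Fin m → Bool) (f : Fin n → Fin m)
                 (χ : Fin (count P) → Fin (count Q)) : Set where
  field
    select-χ : ∀ a → select Q (χ a) ≡ f (select P a)
open Restricts

restrict : ∀ {n m} (P : Fin n → Bool) (Q : Fin m → Bool) (f : Fin n → Fin m) →
           (∀ x → P x ≡ true → Q (f x) ≡ true) → Fin (count P) → Fin (count Q)
restrict P Q f P⇒Q a = index Q (f (select P a)) (P⇒Q _ (select-sat P a))

restrict-restricts : ∀ {n m} (P : Fin n → Bool) (Q : Fin m → Bool) f P⇒Q →
                     Restricts P Q f (restrict P Q f P⇒Q)
restrict-restricts P Q f P⇒Q = record { select-χ = λ a → select-index Q _ _ }

Restricts-∘ : ∀ {n m k} {P : Fin n → Bool} {Q : Fin m → Bool} {S : Fin k → Bool} {f g χ χ'} →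
              Restricts Q S g χ → Restricts P Q f χ' → Restricts P S (g ∘ f) (χ ∘ χ')
Restricts-∘ {g = g} rg rf = record { select-χ = λ a → trans (select-χ rg _) (cong g (select-χ rf a)) }

Restricts-injective : ∀ {n m} {P : Fin n → Bool} {Q : Fin m → Bool} {f χ} →
                      (∀ x y → f x ≡ f y → x ≡ y) → Restricts P Q f χ → ∀ a b → χ a ≡ χ b → a ≡ b
Restricts-injective {P = P} f-inj r a b χa≡χb =
  select-injective P (f-inj _ _ (trans (≡.sym (select-χ r a)) (trans (cong (select _) χa≡χb) (select-χ r b))))

Restricts-hom : ∀ {F G : Graph} {P Q f χ} → IsHom F G f → Restricts P Q f χ →
                IsHom (induced F P) (induced G Q) χ
Restricts-hom {G = G} hom r a b ab =
  subst₂ (λ s t → adj G s t ≡ true) (≡.sym (select-χ r a)) (≡.sym (select-χ r b)) (hom _ _ ab)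

NoIsolatedIn : (G : Graph) → (Fin (n G) → Bool) → Set
NoIsolatedIn G V = ∀ u → V u ≡ true → ∃[ w ] V w ≡ true × adj G u w ≡ true

module _ {F G : Graph} {ψ : Fin (n F) → Fin (n G)} {V : Fin (n G) → Bool}
         {χ : Fin (count (V ∘ ψ)) → Fin (count V)} (r : Restricts (V ∘ ψ) V ψ χ) where
  private
    Fᵥ = induced F (V ∘ ψ)
    Gᵥ = induced G V
    s  = select (V ∘ ψ)

    ≟-restrict : ∀ b v → ⌊ χ b ≟ v ⌋ ≡ ⌊ ψ (s b) ≟ select V v ⌋
    ≟-restrict b v = trans (≡.sym (select-≟ V (χ b) v)) (cong (λ t → ⌊ t ≟ select V v ⌋) (select-χ r b))

    fibre⊆V : ∀ v z → ⌊ ψ z ≟ select V v ⌋ ≡ true → V (ψ z) ≡ true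
    fibre⊆V v z e = subst (λ t → V t ≡ true) (≡.sym (≟⇒≡ _ _ e)) (select-sat V v)

    adj-restrict : ∀ a v → adj Gᵥ (χ a) v ≡ adj G (ψ (s a)) (select V v)
    adj-restrict a v = cong (λ t → adj G t (select V v)) (select-χ r a)

  nbrsIn-restrict : ∀ a v → nbrsIn Fᵥ Gᵥ χ a v ≡ nbrsIn F G ψ (s a) (select V v)
  nbrsIn-restrict a v = trans (count-cong (λ b → cong (adj F (s a) (s b) ∧_) (≟-restrict b v)))
                              (count-∘select (V ∘ ψ) q (λ z qz → fibre⊆V v z (∧-conicalʳ _ _ qz)))
    where
    q : Fin (n F) → Bool
    q z = adj F (s a) z ∧ ⌊ ψ z ≟ select V v ⌋

  φOdd-restrict : ∀ a → φOdd F G ψ (s a) → φOdd Fᵥ Gᵥ χ a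
  φOdd-restrict a odd v av =
    subst Odd (≡.sym (nbrsIn-restrict a v)) (odd _ (trans (≡.sym (adj-restrict a v)) av))

  φEven-restrict : ∀ a → φEven F G ψ (s a) → φEven Fᵥ Gᵥ χ a
  φEven-restrict a even v av =
    subst Even (≡.sym (nbrsIn-restrict a v)) (even _ (trans (≡.sym (adj-restrict a v)) av))

  -- A φ-even vertex of F stays even in F[ψ⁻¹V] as long as its image has a neighbour in V.
  φOdd-unrestrict : NoIsolatedIn G V → ∀ a → φOdd F G ψ (s a) ⊎ φEven F G ψ (s a) →
                    φOdd Fᵥ Gᵥ χ a → φOdd F G ψ (s a)
  φOdd-unrestrict noIso a (inj₁ odd) _ = odd
  φOdd-unrestrict noIso a (inj₂ even) oddᵥ with noIso (ψ (s a)) (select-sat (V ∘ ψ) a)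
  ... | w , Vw , aw =
    ⊥-elim (false≢true (trans (≡.sym (even _ aw′)) (subst Odd (nbrsIn-restrict a w′) (oddᵥ w′ awᵥ))))
    where
    w′ = index V w Vw
    aw′ : adj G (ψ (s a)) (select V w′) ≡ true
    aw′ = subst (λ t → adj G _ t ≡ true) (≡.sym (select-index V w Vw)) aw
    awᵥ : adj Gᵥ (χ a) w′ ≡ true
    awᵥ = trans (adj-restrict a w′) aw′

  module _ (noIso : NoIsolatedIn G V) (parity : ∀ x → φOdd F G ψ x ⊎ φEven F G ψ x) where
    isφOdd-restrict : ∀ a → isφOdd Fᵥ Gᵥ χ a ≡ isφOdd F G ψ (s a)
    isφOdd-restrict a = ≡true-ext
      (λ oddᵥ → φOdd⇒isφOdd F G ψ _ (φOdd-unrestrict noIso a (parity (s a)) (isφOdd⇒φOdd Fᵥ Gᵥ χ a oddᵥ)))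
      (λ odd → φOdd⇒isφOdd Fᵥ Gᵥ χ a (φOdd-restrict a (isφOdd⇒φOdd F G ψ _ odd)))

    oddInFibre-restrict : ∀ v → oddInFibre Fᵥ Gᵥ χ v ≡ oddInFibre F G ψ (select V v)
    oddInFibre-restrict v =
      trans (count-cong (λ a → cong₂ _∧_ (≟-restrict a v) (isφOdd-restrict a)))
            (count-∘select (V ∘ ψ) q (λ z qz → fibre⊆V v z (∧-conicalˡ _ _ qz)))
      where
      q : Fin (n F) → Bool
      q z = ⌊ ψ z ≟ select V v ⌋ ∧ isφOdd F G ψ z

  Restricts-oddomorphism : IsOddomorphism F G ψ → NoIsolatedIn G V → IsOddomorphism Fᵥ Gᵥ χ
  Restricts-oddomorphism (hom , parity , fibre) noIso =
    Restricts-hom {F} {G} hom r ,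
    (λ a → Data.Sum.map (φOdd-restrict a) (φEven-restrict a) (parity (s a))) ,
    (λ v → subst Odd (≡.sym (oddInFibre-restrict noIso parity v)) (fibre (select V v)))

restrict-weakOddomorphism : ∀ {F G : Graph} {φ} {V : Fin (n G) → Bool} →
                            IsWeakOddomorphism F G φ → NoIsolatedIn G V →
                            IsWeakOddomorphism (induced F (V ∘ φ)) (induced G V)
                                               (restrict (V ∘ φ) V φ (λ _ Vφx → Vφx))
restrict-weakOddomorphism {F} {G} {φ} {V} (hom , F' , ι , (ι-inj , ι-hom) , oddo) noIso =
  Restricts-hom {F} {G} hom rφ ,
  induced F' (V ∘ φ ∘ ι) , ιᵥ ,
  (Restricts-injective ι-inj rι , Restricts-hom {F'} {F} ι-hom rι) ,
  Restricts-oddomorphism {F'} {G} (Restricts-∘ rφ rι) oddo noIso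
  where
  rφ = restrict-restricts (V ∘ φ) V φ (λ _ Vφx → Vφx)
  ιᵥ = restrict (V ∘ φ ∘ ι) (V ∘ φ) ι (λ _ Vφιx → Vφιx)
  rι = restrict-restricts (V ∘ φ ∘ ι) (V ∘ φ) ι (λ _ Vφιx → Vφιx)

weakOddomorphism-surjective : ∀ {F G : Graph} {φ} → IsWeakOddomorphism F G φ → ∀ v → ∃[ a ] φ a ≡ v
weakOddomorphism-surjective (_ , _ , ι , _ , _ , _ , fibre) v
  with count≢0⇒∃ _ (Odd⇒≢0 (fibre v))
... | a , a-odd-in-fibre = ι a , ≟⇒≡ _ _ (∧-conicalˡ _ _ a-odd-in-fibre)

NoIsolated : Graph → Set
NoIsolated H = ∀ h → ∃[ h' ] adj H h h' ≡ true

Fin-subsingleton⊎nontrivial : ∀ m → (∀ (i j : Fin m) → i ≡ j) ⊎ (∀ (i : Fin m) → ∃[ j ] j ≢ i)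
Fin-subsingleton⊎nontrivial zero          = inj₁ λ ()
Fin-subsingleton⊎nontrivial (suc zero)    = inj₁ λ { zero zero → refl }
Fin-subsingleton⊎nontrivial (suc (suc m)) = inj₂ λ { zero → suc zero , λ () ; (suc i) → zero , λ () }

connected⇒trivial⊎noIsolated : ∀ {H : Graph} → Connected H → (∀ h h' → h ≡ h') ⊎ NoIsolated H
connected⇒trivial⊎noIsolated {H} (_ , walk) with Fin-subsingleton⊎nontrivial (n H)
... | inj₁ trivial = inj₁ trivial
... | inj₂ other   = inj₂ noIsolated
  where
  noIsolated : NoIsolated H
  noIsolated h with other h
  ... | h' , h'≢h with Walk-head (walk h h')
  ...   | inj₁ h≡h'         = ⊥-elim (h'≢h (≡.sym h≡h'))
  ...   | inj₂ (z , hz , _) = z , hz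

-- A vertex u in the branch set of h reaches, inside that branch set, an endpoint of an edge towards
-- the branch set of a neighbour of h: its first step, or that edge itself.
support-noIsolated : ∀ {H G : Graph} {R} (m : MinorWithin H G R) → NoIsolated H →
                     NoIsolatedIn G (support (branch m))
support-noIsolated (minorWithin β (_ , connected , edges) _) noIso u βu with β u in βu≡
... | just h with noIso h
...   | h' , hh' with edges h h' hh'
...     | x , y , βx , βy , xy with Walk-head (connected h u x βu≡ βx)
...       | inj₁ refl           = y , cong is-just βy , xy
...       | inj₂ (w , uw , βw) = w , cong is-just βw , uw

pointMinor : ∀ {H G : Graph} {R} → (∀ h h' → h ≡ h') → Fin (n H) → ∀ a → R a ≡ true → MinorWithin H G R
pointMinor {H} {G} {R} trivial h₀ a Ra = minorWithin β (onto , connected , edges) β⊆R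
  where
  β : Fin (n G) → Maybe (Fin (n H))
  β x = if ⌊ x ≟ a ⌋ then just h₀ else nothing

  β≡just : ∀ {x h} → β x ≡ just h → x ≡ a
  β≡just {x} e with x ≟ a | e
  ... | yes x≡a | _ = x≡a
  ... | no _    | ()

  onto : ∀ h → ∃[ x ] β x ≡ just h
  onto h = a , trans (cong (if_then just h₀ else nothing) (≟-refl a)) (cong just (trivial h₀ h))

  connected : ∀ h x y → β x ≡ just h → β y ≡ just h → Walk G (λ z → β z ≡ just h) x y
  connected h x y βx βy rewrite β≡just βx | β≡just βy = here

  edges : ∀ h h' → adj H h h' ≡ true → ∃[ x ] ∃[ y ] (β x ≡ just h × β y ≡ just h' × adj G x y ≡ true)
  edges h h' hh' rewrite trivial h' h = ⊥-elim (false≢true (trans (≡.sym (irrefl H h)) hh'))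

  β⊆R : Within β R
  β⊆R x βx rewrite β≡just βx = Ra

pullback-trivialMinor : ∀ {F G H : Graph} {φ R} → IsWeakOddomorphism F G φ →
                        (∀ h h' → h ≡ h') → Fin (n H) → MinorWithin H G R → MinorWithin H F (R ∘ φ)
pullback-trivialMinor {F} {G} wo trivial h₀ (minorWithin β (onto , _) β⊆R) with onto h₀
... | x , βx with weakOddomorphism-surjective {F} {G} wo x
...   | a , refl = pointMinor trivial h₀ a (β⊆R _ βx)

module _ {ℓ} {M : Fin ℓ → Graph} (connected : ∀ i → Connected (M i)) (closed : ClosedUnderWeakOddo (Excl M))
         {F G : Graph} {φ : Fin (n F) → Fin (n G)} (wo : IsWeakOddomorphism F G φ) where

  open RawMonad (¬¬-Monad {a = 0ℓ})

  pullback-nontrivialMinor : ∀ {i R} → NoIsolated (M i) → MinorWithin (M i) G R →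
                             ¬ ¬ (∃[ j ] MinorWithin (M j) F (R ∘ φ))
  pullback-nontrivialMinor {i} noIso m@(minorWithin β model β⊆R) ¬pullback =
    closed (induced F (V ∘ φ)) (induced G V) _ Fᵥ∈𝓕
           (restrict-weakOddomorphism {F} {G} {V = V} wo (support-noIsolated m noIso)) i Mi≼Gᵥ
    where
    V = support β

    Mi≼Gᵥ : M i ≼ induced G V
    Mi≼Gᵥ = MinorWithin⇒≼induced (MinorWithin-support m)

    Fᵥ∈𝓕 : Excl M (induced F (V ∘ φ))
    Fᵥ∈𝓕 j Mj≼Fᵥ =
      ¬pullback (j , MinorWithin-weaken (λ x → support⊆ β⊆R (φ x)) (≼induced⇒MinorWithin Mj≼Fᵥ))

  pullback-connectedMinor : ∀ {i R} → MinorWithin (M i) G R → ¬ ¬ (∃[ j ] MinorWithin (M j) F (R ∘ φ))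
  pullback-connectedMinor {i} m with connected⇒trivial⊎noIsolated (connected i)
  ... | inj₁ trivial = pure (i , pullback-trivialMinor {F} {G} wo trivial (fromℕ< (proj₁ (connected i))) m)
  ... | inj₂ noIso   = pullback-nontrivialMinor noIso m

  pullback-⨄ : ∀ {k} (c : Fin k → Fin ℓ) {R} → MinorWithin (⨄ (M ∘ c)) G R →
               ¬ ¬ (Σ[ c′ ∈ (Fin k → Fin ℓ) ] MinorWithin (⨄ (M ∘ c′)) F (R ∘ φ))
  pullback-⨄ {zero}  c _ = pure (c , emptyMinor)
  pullback-⨄ {suc k} c m with MinorWithin-⊕-split {M (c zero)} {⨄ (M ∘ c ∘ suc)} m
  ... | D , m₁ , m₂ = do
    j , m₁′ ← pullback-connectedMinor m₁
    c′ , m₂′ ← pullback-⨄ (c ∘ suc) m₂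
    pure (j ∷ c′ , MinorWithin-⊕-combine (DisjointParts-∘ D φ) m₁′ m₂′)

lemma5p2 : ∀ {ℓ} (M : Fin ℓ → Graph) → (∀ i → Connected (M i)) →
           ∀ (k : ℕ) → 1 ≤ k →
           ClosedUnderWeakOddo (Excl M) → ClosedUnderWeakOddo (Excl^ M k)
lemma5p2 M connected k _ closed F G φ F∈𝓕ᵏ wo c (β , model) =
  pullback-⨄ connected closed {F} {G} wo c (minorWithin β model λ _ _ → refl)
    λ { (c′ , minorWithin β′ model′ _) → F∈𝓕ᵏ c′ (β′ , model′) }
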